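{- Let $\mathbb{F}$ be a finite field of order $q$ with $\mathrm{char}(\mathbb{F})\neq 2$, and let $g$ be a two-dimensional subspace of $\mathbb{F}^4$. Then $g$ generates a linear sudoku square of parallel type if and only if there exists an invertible matrix $C\in M^{2\times 2}(\mathbb{F})$ which is not lower triangular (i.e. whose upper-right entry is nonzero) such that $g=\left[\begin{array}{c} I\\ C\end{array}\right]$.
   Context: For $A,B\in M^{2\times 2}(\mathbb{F})$, $\left[\begin{array}{c} A\\ B\end{array}\right]$ denotes the subspace of $\mathbb{F}^4$ spanned by the columns of the $4\times 2$ matrix $\begin{pmatrix} A\\ B\end{pmatrix}$; $I$ is the $2\times 2$ identity matrix. A sudoku square of order $n^2$ is a latin square of order $n^2$ such that, when the array is partitioned into $n\times n$ subsquares in the natural way, each subsquare contains every symbol. Locations of an array of order $q^2$ are identified with vectors $(x_1,x_2,x_3,x_4)\in\mathbb{F}^4$: $x_1$ is the large row (which horizontal band of $q$ subsquares), $x_2$ the mini row (row within the band), $x_3$ the large column, $x_4$ the mini column; so the row of a location is determined by $(x_1,x_2)$, its column by $(x_3,x_4)$, and its subsquare by $(x_1,x_3)$. For a two-dimensional subspace $g\subseteq\mathbb{F}^4$, the array $M_g$ assigns to the locations in each coset $x+g$ a common symbol, distinct cosets receiving distinct symbols. We say $g$ generates a linear sudoku square of parallel type if $M_g$ is a sudoku square. -}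

module Defs where

open import Level using (Level; _⊔_; suc)
open import Algebra.Bundles using (CommutativeRing)
open import Data.Nat using (ℕ)
open import Data.Fin using (Fin)
open import Data.Product using (Σ; ∃; _×_; _,_)
open import Relation.Nullary using (¬_)
open import Relation.Binary.PropositionalEquality using (_≡_)
open import Function.Bundles using (_⇔_)

record FiniteField (c ℓ : Level) : Set (suc (c ⊔ ℓ)) where
  field
    commRing : CommutativeRing c ℓ
  open CommutativeRing commRing public
  field
    0≉1      : ¬ (0# ≈ 1#)
    inverse  : ∀ x → ¬ (x ≈ 0#) → ∃ λ y → (x * y) ≈ 1#
    q        : ℕ
    enum     : Fin q → Carrier
    enum-surj : ∀ x → ∃ λ i → enum i ≈ x
    enum-inj  : ∀ i j → enum i ≈ enum j → i ≡ j

module _ {c ℓ : Level} (F : FiniteField c ℓ) where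
  open FiniteField F

  CharNot2 : Set ℓ
  CharNot2 = ¬ ((1# + 1#) ≈ 0#)

  record V4 : Set c where
    constructor v4
    field
      x₁ x₂ x₃ x₄ : Carrier
  open V4 public

  _≈V_ : V4 → V4 → Set ℓ
  u ≈V v = (x₁ u ≈ x₁ v) × (x₂ u ≈ x₂ v) × (x₃ u ≈ x₃ v) × (x₄ u ≈ x₄ v)

  _+V_ : V4 → V4 → V4
  u +V v = v4 (x₁ u + x₁ v) (x₂ u + x₂ v) (x₃ u + x₃ v) (x₄ u + x₄ v)

  _·V_ : Carrier → V4 → V4
  a ·V v = v4 (a * x₁ v) (a * x₂ v) (a * x₃ v) (a * x₄ v)

  -V_ : V4 → V4
  -V v = v4 (- x₁ v) (- x₂ v) (- x₃ v) (- x₄ v)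

  0V : V4
  0V = v4 0# 0# 0# 0#

  record Subspace (p : Level) : Set (c ⊔ ℓ ⊔ suc p) where
    field
      _∈g_   : V4 → Set p
      ∈-resp : ∀ {u v} → u ≈V v → _∈g_ u → _∈g_ v
      ∈-0    : _∈g_ 0V
      ∈-+    : ∀ {u v} → _∈g_ u → _∈g_ v → _∈g_ (u +V v)
      ∈-·    : ∀ a {v} → _∈g_ v → _∈g_ (a ·V v)
  open Subspace public

  TwoDimensional : ∀ {p} → Subspace p → Set (c ⊔ ℓ ⊔ p)
  TwoDimensional g = Σ V4 λ u → Σ V4 λ v →
      (g ∈g u) × (g ∈g v)
    × (∀ a b → ((a ·V u) +V (b ·V v)) ≈V 0V → (a ≈ 0#) × (b ≈ 0#))
    × (∀ w → g ∈g w → ∃ λ a → ∃ λ b → w ≈V ((a ·V u) +V (b ·V v)))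

  ∃!₂ : ∀ {p} → (Carrier → Carrier → Set p) → Set (c ⊔ ℓ ⊔ p)
  ∃!₂ P = ∃ λ s → ∃ λ t → P s t × (∀ s' t' → P s' t' → (s' ≈ s) × (t' ≈ t))

  -- location y carries the same symbol as location x in M_g, i.e. y ∈ x + g
  SameSymbol : ∀ {p} → Subspace p → V4 → V4 → Set p
  SameSymbol g x y = g ∈g (y +V (-V x))

  -- M_g is a sudoku square: every symbol (coset x + g) occurs exactly once in
  -- each row (fixed x₁,x₂), each column (fixed x₃,x₄) and each subsquare
  -- (fixed x₁,x₃).  (M_g has exactly q² symbols since g is 2-dimensional.)
  IsSudokuSquare : ∀ {p} → Subspace p → Set (c ⊔ ℓ ⊔ p)
  IsSudokuSquare g = ∀ x →
      (∀ a b → ∃!₂ λ s t → SameSymbol g x (v4 a b s t))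
    × (∀ s t → ∃!₂ λ a b → SameSymbol g x (v4 a b s t))
    × (∀ a s → ∃!₂ λ b t → SameSymbol g x (v4 a b s t))

  GeneratesParallelSudoku : ∀ {p} → Subspace p → Set (c ⊔ ℓ ⊔ p)
  GeneratesParallelSudoku = IsSudokuSquare

  record M2 : Set c where
    constructor m2
    field
      m₁₁ m₁₂ m₂₁ m₂₂ : Carrier
  open M2 public

  _≈M_ : M2 → M2 → Set ℓ
  A ≈M B = (m₁₁ A ≈ m₁₁ B) × (m₁₂ A ≈ m₁₂ B) × (m₂₁ A ≈ m₂₁ B) × (m₂₂ A ≈ m₂₂ B)

  _*M_ : M2 → M2 → M2
  A *M B = m2 (m₁₁ A * m₁₁ B + m₁₂ A * m₂₁ B) (m₁₁ A * m₁₂ B + m₁₂ A * m₂₂ B)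
              (m₂₁ A * m₁₁ B + m₂₂ A * m₂₁ B) (m₂₁ A * m₁₂ B + m₂₂ A * m₂₂ B)

  I₂ : M2
  I₂ = m2 1# 0# 0# 1#

  Invertible : M2 → Set (c ⊔ ℓ)
  Invertible C = ∃ λ D → ((C *M D) ≈M I₂) × ((D *M C) ≈M I₂)

  -- membership in [ A ; B ]: the column space of the 4×2 matrix (A over B)
  _∈[_/_] : V4 → M2 → M2 → Set (c ⊔ ℓ)
  w ∈[ A / B ] = ∃ λ a → ∃ λ b → w ≈V
    ((a ·V v4 (m₁₁ A) (m₂₁ A) (m₁₁ B) (m₂₁ B)) +V
     (b ·V v4 (m₁₂ A) (m₂₂ A) (m₁₂ B) (m₂₂ B)))

  _≡[_/_] : ∀ {p} → Subspace p → M2 → M2 → Set (c ⊔ ℓ ⊔ p)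
  g ≡[ A / B ] = ∀ w → (g ∈g w) ⇔ (w ∈[ A / B ])

-- The symbols of M_g are the cosets of g, so M_g is a sudoku square iff every
-- coset of g meets every translate of the planes {x₁ = x₂ = 0} (rows),
-- {x₃ = x₄ = 0} (columns) and {x₁ = x₃ = 0} (subsquares) in exactly one point.
-- The row condition makes g the graph {(v , C v)} of a 2×2 matrix C; the column
-- condition then says that C is bijective, and the subsquare condition that x₂
-- is determined by x₁ and c₁₁ x₁ + c₁₂ x₂, i.e. that c₁₂ ≠ 0.
module Submission where

open import Level using (Level)
open import Data.Product using (∃; _×_; _,_; proj₁; proj₂)
open import Relation.Nullary using (¬_)
open import Function.Bundles using (_⇔_; mk⇔; Equivalence)
open import Function.Properties.Equivalence using () renaming (sym to ⇔-sym; trans to ⇔-trans)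
open import Defs

module _ {c ℓ : Level} (F : FiniteField c ℓ) where
  open FiniteField F
  open import Relation.Binary.Reasoning.Setoid setoid
  open import Algebra.Properties.Group +-group using (ε⁻¹≈ε; //-rightDividesˡ; //-rightDividesʳ)
  open import Algebra.Properties.AbelianGroup +-abelianGroup using (xyx⁻¹≈y)
  open import Algebra.Solver.Ring.NaturalCoefficients.Default commutativeSemiring

  x*1+y*0≈x : ∀ x y → x * 1# + y * 0# ≈ x
  x*1+y*0≈x x y = trans (+-cong (*-identityʳ x) (zeroʳ y)) (+-identityʳ x)

  x*0+y*1≈y : ∀ x y → x * 0# + y * 1# ≈ y
  x*0+y*1≈y x y = trans (+-cong (zeroʳ x) (*-identityʳ y)) (+-identityˡ y)

  1*x+0*y≈x : ∀ x y → 1# * x + 0# * y ≈ x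
  1*x+0*y≈x x y = trans (+-cong (*-identityˡ x) (zeroˡ y)) (+-identityʳ x)

  0*x+1*y≈y : ∀ x y → 0# * x + 1# * y ≈ y
  0*x+1*y≈y x y = trans (+-cong (zeroˡ x) (*-identityˡ y)) (+-identityˡ y)

  x-0≈x : ∀ x → x + - 0# ≈ x
  x-0≈x x = trans (+-congˡ ε⁻¹≈ε) (+-identityʳ x)

  ≈V-sym : ∀ {u v} → _≈V_ F u v → _≈V_ F v u
  ≈V-sym (e₁ , e₂ , e₃ , e₄) = sym e₁ , sym e₂ , sym e₃ , sym e₄

  unit-linear-solution : ∀ {u k} → u * k ≈ 1# → ∀ x y β → (y ≈ x + u * β) ⇔ (β ≈ k * (y + - x))
  unit-linear-solution {u} {k} uk≈1 x y β = mk⇔ solved solves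
    where
    solved : y ≈ x + u * β → β ≈ k * (y + - x)
    solved y≈ = sym (begin
      k * (y + - x)           ≈⟨ *-congˡ (+-congʳ y≈) ⟩
      k * (x + u * β + - x)   ≈⟨ *-congˡ (xyx⁻¹≈y x (u * β)) ⟩
      k * (u * β)             ≈⟨ *-assoc k u β ⟨
      k * u * β               ≈⟨ *-congʳ (trans (*-comm k u) uk≈1) ⟩
      1# * β                  ≈⟨ *-identityˡ β ⟩
      β                       ∎)
    solves : β ≈ k * (y + - x) → y ≈ x + u * β
    solves β≈ = sym (begin
      x + u * β               ≈⟨ +-congˡ (*-congˡ β≈) ⟩
      x + u * (k * (y + - x)) ≈⟨ +-congˡ (*-assoc u k _) ⟨
      x + u * k * (y + - x)   ≈⟨ +-congˡ (*-congʳ uk≈1) ⟩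
      x + 1# * (y + - x)      ≈⟨ +-congˡ (*-identityˡ _) ⟩
      x + (y + - x)           ≈⟨ +-comm x _ ⟩
      y + - x + x             ≈⟨ //-rightDividesˡ x y ⟩
      y                       ∎)

  module _ {p} {P : Carrier → Carrier → Set p} where

    ∃!₂-unique : ∃!₂ F P → ∀ {s t s' t'} → P s t → P s' t' → (s ≈ s') × (t ≈ t')
    ∃!₂-unique (_ , _ , _ , unique) Pst Ps't' =
      let s≈ , t≈ = unique _ _ Pst
          s'≈ , t'≈ = unique _ _ Ps't'
      in trans s≈ (sym s'≈) , trans t≈ (sym t'≈)

    ∃!₂-cong : ∀ {q} {Q : Carrier → Carrier → Set q} → (∀ s t → P s t ⇔ Q s t) → ∃!₂ F P → ∃!₂ F Q
    ∃!₂-cong P⇔Q (s , t , Pst , unique) =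
      s , t , Equivalence.to (P⇔Q s t) Pst , λ s' t' Qs't' → unique s' t' (Equivalence.from (P⇔Q s' t') Qs't')

    ∃!₂-translate : (∀ {s s' t t'} → s ≈ s' → t ≈ t' → P s t → P s' t') →
                    ∀ u v → ∃!₂ F P → ∃!₂ F (λ s t → P (s + - u) (t + - v))
    ∃!₂-translate resp u v (s , t , Pst , unique) =
      s + u , t + v , resp (sym (//-rightDividesʳ u s)) (sym (//-rightDividesʳ v t)) Pst , translated
      where
      translated : ∀ s' t' → P (s' + - u) (t' + - v) → (s' ≈ s + u) × (t' ≈ t + v)
      translated s' t' P' =
        let s'-u≈s , t'-v≈t = unique _ _ P'
        in trans (sym (//-rightDividesˡ u s')) (+-congʳ s'-u≈s) ,
           trans (sym (//-rightDividesˡ v t')) (+-congʳ t'-v≈t)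

  apply₁ apply₂ : M2 F → Carrier → Carrier → Carrier
  apply₁ C α β = m₁₁ C * α + m₁₂ C * β
  apply₂ C α β = m₂₁ C * α + m₂₂ C * β

  Sends : M2 F → Carrier → Carrier → Carrier → Carrier → Set ℓ
  Sends C α β σ τ = (σ ≈ apply₁ C α β) × (τ ≈ apply₂ C α β)

  RightInverse : M2 F → M2 F → Set ℓ
  RightInverse C D = _≈M_ F (_*M_ F C D) (I₂ F)

  Sends-apply : ∀ C α β → Sends C α β (apply₁ C α β) (apply₂ C α β)
  Sends-apply C α β = refl , refl

  Sends-cong : ∀ {C α β σ τ α' β' σ' τ'} → α ≈ α' → β ≈ β' → σ ≈ σ' → τ ≈ τ' →
               Sends C α β σ τ → Sends C α' β' σ' τ'
  Sends-cong α≈ β≈ σ≈ τ≈ (σ≈Cv , τ≈Cv) =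
    trans (sym σ≈) (trans σ≈Cv (+-cong (*-congˡ α≈) (*-congˡ β≈))) ,
    trans (sym τ≈) (trans τ≈Cv (+-cong (*-congˡ α≈) (*-congˡ β≈)))

  Sends-e₁ : ∀ C → Sends C 1# 0# (m₁₁ C) (m₂₁ C)
  Sends-e₁ C = sym (x*1+y*0≈x _ _) , sym (x*1+y*0≈x _ _)

  Sends-e₂ : ∀ C → Sends C 0# 1# (m₁₂ C) (m₂₂ C)
  Sends-e₂ C = sym (x*0+y*1≈y _ _) , sym (x*0+y*1≈y _ _)

  Sends-I₂ : ∀ {α β σ τ} → Sends (I₂ F) α β σ τ → (σ ≈ α) × (τ ≈ β)
  Sends-I₂ (σ≈ , τ≈) = trans σ≈ (1*x+0*y≈x _ _) , trans τ≈ (0*x+1*y≈y _ _)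

  Sends-≈M : ∀ {A B α β σ τ} → _≈M_ F A B → Sends A α β σ τ → Sends B α β σ τ
  Sends-≈M (a₁₁≈ , a₁₂≈ , a₂₁≈ , a₂₂≈) (σ≈ , τ≈) =
    trans σ≈ (+-cong (*-congʳ a₁₁≈) (*-congʳ a₁₂≈)) ,
    trans τ≈ (+-cong (*-congʳ a₂₁≈) (*-congʳ a₂₂≈))

  Sends-*M : ∀ {A B α β σ τ ρ υ} → Sends B α β σ τ → Sends A σ τ ρ υ → Sends (_*M_ F A B) α β ρ υ
  Sends-*M {A} {B} {α} {β} (σ≈ , τ≈) (ρ≈ , υ≈) =
    trans ρ≈ (trans (+-cong (*-congˡ σ≈) (*-congˡ τ≈)) (row-assoc (m₁₁ A) (m₁₂ A))) ,
    trans υ≈ (trans (+-cong (*-congˡ σ≈) (*-congˡ τ≈)) (row-assoc (m₂₁ A) (m₂₂ A)))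
    where
    row-assoc : ∀ x y → x * apply₁ B α β + y * apply₂ B α β
                       ≈ (x * m₁₁ B + y * m₂₁ B) * α + (x * m₁₂ B + y * m₂₂ B) * β
    row-assoc x y = solve 8
      (λ x y b₁₁ b₁₂ b₂₁ b₂₂ α β →
         x :* (b₁₁ :* α :+ b₁₂ :* β) :+ y :* (b₂₁ :* α :+ b₂₂ :* β)
           := (x :* b₁₁ :+ y :* b₂₁) :* α :+ (x :* b₁₂ :+ y :* b₂₂) :* β)
      refl x y (m₁₁ B) (m₁₂ B) (m₂₁ B) (m₂₂ B) α β

  Sends-inverse : ∀ {A B α β σ τ ρ υ} → RightInverse A B →
                  Sends B α β σ τ → Sends A σ τ ρ υ → (ρ ≈ α) × (υ ≈ β)
  Sends-inverse AB≈I sB sA = Sends-I₂ (Sends-≈M AB≈I (Sends-*M sB sA))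

  Sends-rightInverse : ∀ {C D σ τ} → RightInverse C D → Sends C (apply₁ D σ τ) (apply₂ D σ τ) σ τ
  Sends-rightInverse {C} {D} CD≈I =
    let ρ≈σ , υ≈τ = Sends-inverse CD≈I (Sends-apply D _ _) (Sends-apply C _ _)
    in Sends-cong refl refl ρ≈σ υ≈τ (Sends-apply C _ _)

  Sends-columns⇒RightInverse : ∀ {C D} → Sends C (m₁₁ D) (m₂₁ D) 1# 0# → Sends C (m₁₂ D) (m₂₂ D) 0# 1# →
                               RightInverse C D
  Sends-columns⇒RightInverse (1≈ , 0≈) (0≈' , 1≈') = sym 1≈ , sym 0≈' , sym 0≈ , sym 1≈'

  right-inverse⇒left-inverse : ∀ {C D} → RightInverse C D →
    (∀ {α β α' β' σ τ} → Sends C α β σ τ → Sends C α' β' σ τ → (α ≈ α') × (β ≈ β')) →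
    RightInverse D C
  right-inverse⇒left-inverse {C} {D} CD≈I injective =
    proj₁ (D-undoes (Sends-e₁ C)) , proj₁ (D-undoes (Sends-e₂ C)) ,
    proj₂ (D-undoes (Sends-e₁ C)) , proj₂ (D-undoes (Sends-e₂ C))
    where
    D-undoes : ∀ {α β σ τ} → Sends C α β σ τ → (apply₁ D σ τ ≈ α) × (apply₂ D σ τ ≈ β)
    D-undoes = injective (Sends-rightInverse CD≈I)

  Sends-image : ∀ C α β → ∃!₂ F (Sends C α β)
  Sends-image C α β = apply₁ C α β , apply₂ C α β , Sends-apply C α β , λ _ _ sC → sC

  Sends-preimage : ∀ {C} → Invertible F C → ∀ σ τ → ∃!₂ F (λ α β → Sends C α β σ τ)
  Sends-preimage {C} (D , CD≈I , DC≈I) σ τ =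
    apply₁ D σ τ , apply₂ D σ τ , Sends-rightInverse CD≈I , unique
    where
    unique : ∀ α β → Sends C α β σ τ → (α ≈ apply₁ D σ τ) × (β ≈ apply₂ D σ τ)
    unique α β sC = let α≈ , β≈ = Sends-inverse DC≈I sC (Sends-apply D σ τ) in sym α≈ , sym β≈

  Sends-mixed : ∀ {C} → ¬ (m₁₂ C ≈ 0#) → ∀ α σ → ∃!₂ F (λ β τ → Sends C α β σ τ)
  Sends-mixed {C} c₁₂≉0 α σ with inverse (m₁₂ C) c₁₂≉0
  ... | k , c₁₂k≈1 = β₀ , apply₂ C α β₀ , (from (solution β₀) refl , refl) , unique
    where
    open Equivalence
    solution : ∀ β → (σ ≈ m₁₁ C * α + m₁₂ C * β) ⇔ (β ≈ k * (σ + - (m₁₁ C * α)))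
    solution = unit-linear-solution c₁₂k≈1 (m₁₁ C * α) σ
    β₀ : Carrier
    β₀ = k * (σ + - (m₁₁ C * α))
    unique : ∀ β τ → Sends C α β σ τ → (β ≈ β₀) × (τ ≈ apply₂ C α β₀)
    unique β τ (σ≈ , τ≈) = β≈β₀ , trans τ≈ (+-congˡ (*-congˡ β≈β₀))
      where
      β≈β₀ : β ≈ β₀
      β≈β₀ = to (solution β) σ≈

  ∈[I₂/]⇔Sends : ∀ C w → _∈[_/_] F w (I₂ F) C ⇔ Sends C (x₁ w) (x₂ w) (x₃ w) (x₄ w)
  ∈[I₂/]⇔Sends C w = mk⇔ to from
    where
    swap : ∀ {a b x y} u v → a ≈ x → b ≈ y → a * u + b * v ≈ u * x + v * y
    swap u v a≈ b≈ = +-cong (trans (*-comm _ u) (*-congˡ a≈)) (trans (*-comm _ v) (*-congˡ b≈))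
    to : _∈[_/_] F w (I₂ F) C → Sends C (x₁ w) (x₂ w) (x₃ w) (x₄ w)
    to (a , b , w₁≈ , w₂≈ , w₃≈ , w₄≈) =
      let a≈w₁ = sym (trans w₁≈ (x*1+y*0≈x a b))
          b≈w₂ = sym (trans w₂≈ (x*0+y*1≈y a b))
      in trans w₃≈ (swap _ _ a≈w₁ b≈w₂) , trans w₄≈ (swap _ _ a≈w₁ b≈w₂)
    from : Sends C (x₁ w) (x₂ w) (x₃ w) (x₄ w) → _∈[_/_] F w (I₂ F) C
    from (w₃≈ , w₄≈) =
      x₁ w , x₂ w , sym (x*1+y*0≈x _ _) , sym (x*0+y*1≈y _ _) ,
      trans w₃≈ (swap _ _ refl refl) , trans w₄≈ (swap _ _ refl refl)

  module _ {p} (g : Subspace F p) where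

    ∈⇔Sends : ∀ {C} → _≡[_/_] F g (I₂ F) C → ∀ w → (g ∈g w) ⇔ Sends C (x₁ w) (x₂ w) (x₃ w) (x₄ w)
    ∈⇔Sends {C} g≡C w = ⇔-trans (g≡C w) (∈[I₂/]⇔Sends C w)

    columns∈⇒span⊆ : ∀ {C} → g ∈g v4 1# 0# (m₁₁ C) (m₂₁ C) → g ∈g v4 0# 1# (m₁₂ C) (m₂₂ C) →
                      ∀ {w} → _∈[_/_] F w (I₂ F) C → g ∈g w
    columns∈⇒span⊆ e₁∈g e₂∈g (a , b , w≈) = ∈-resp g (≈V-sym w≈) (∈-+ g (∈-· g a e₁∈g) (∈-· g b e₂∈g))

    rows⇒graph : (∀ a b → ∃!₂ F (λ s t → g ∈g v4 a b s t)) → ∃ λ C → _≡[_/_] F g (I₂ F) C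
    rows⇒graph row with row 1# 0# | row 0# 1#
    ... | s₁ , t₁ , e₁∈g , _ | s₂ , t₂ , e₂∈g , _ = C , λ w → mk⇔ (to w) span⊆g
      where
      C : M2 F
      C = m2 s₁ s₂ t₁ t₂
      span⊆g : ∀ {w} → _∈[_/_] F w (I₂ F) C → g ∈g w
      span⊆g = columns∈⇒span⊆ e₁∈g e₂∈g
      to : ∀ w → g ∈g w → _∈[_/_] F w (I₂ F) C
      to w w∈g = Equivalence.from (∈[I₂/]⇔Sends C w) (∃!₂-unique (row (x₁ w) (x₂ w)) w∈g image∈g)
        where
        image∈g : g ∈g v4 (x₁ w) (x₂ w) (apply₁ C (x₁ w) (x₂ w)) (apply₂ C (x₁ w) (x₂ w))
        image∈g = span⊆g (Equivalence.from (∈[I₂/]⇔Sends C _) (Sends-apply C _ _))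

    graph⇒sudoku : ∀ {C} → _≡[_/_] F g (I₂ F) C → Invertible F C → ¬ (m₁₂ C ≈ 0#) → IsSudokuSquare F g
    graph⇒sudoku {C} g≡C invertible c₁₂≉0 x =
        (λ a b → ∃!₂-cong (λ s t → ⇔-sym (sameSymbol⇔Sends a b s t))
                   (∃!₂-translate (Sends-cong refl refl) (x₃ x) (x₄ x) (Sends-image C _ _)))
      , (λ s t → ∃!₂-cong (λ a b → ⇔-sym (sameSymbol⇔Sends a b s t))
                   (∃!₂-translate (λ α≈ β≈ → Sends-cong α≈ β≈ refl refl) (x₁ x) (x₂ x)
                     (Sends-preimage invertible _ _)))
      , (λ a s → ∃!₂-cong (λ b t → ⇔-sym (sameSymbol⇔Sends a b s t))
                   (∃!₂-translate (λ β≈ τ≈ → Sends-cong refl β≈ refl τ≈) (x₂ x) (x₄ x)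
                     (Sends-mixed c₁₂≉0 _ _)))
      where
      sameSymbol⇔Sends : ∀ a b s t → SameSymbol F g x (v4 a b s t) ⇔
                         Sends C (a + - x₁ x) (b + - x₂ x) (s + - x₃ x) (t + - x₄ x)
      sameSymbol⇔Sends a b s t = ∈⇔Sends g≡C _

    module _ (sudoku : IsSudokuSquare F g) where

      sameSymbol-0V⇔∈ : ∀ w → SameSymbol F g (0V F) w ⇔ (g ∈g w)
      sameSymbol-0V⇔∈ w = mk⇔ (∈-resp g (x-0≈x _ , x-0≈x _ , x-0≈x _ , x-0≈x _))
                               (∈-resp g (sym (x-0≈x _) , sym (x-0≈x _) , sym (x-0≈x _) , sym (x-0≈x _)))

      row₀ : ∀ a b → ∃!₂ F (λ s t → g ∈g v4 a b s t)
      row₀ a b = ∃!₂-cong (λ s t → sameSymbol-0V⇔∈ _) (proj₁ (sudoku (0V F)) a b)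

      column₀ : ∀ s t → ∃!₂ F (λ a b → g ∈g v4 a b s t)
      column₀ s t = ∃!₂-cong (λ a b → sameSymbol-0V⇔∈ _) (proj₁ (proj₂ (sudoku (0V F))) s t)

      subsquare₀ : ∀ a s → ∃!₂ F (λ b t → g ∈g v4 a b s t)
      subsquare₀ a s = ∃!₂-cong (λ b t → sameSymbol-0V⇔∈ _) (proj₂ (proj₂ (sudoku (0V F))) a s)

      sudoku⇒graph : ∃ λ C → Invertible F C × ¬ (m₁₂ C ≈ 0#) × _≡[_/_] F g (I₂ F) C
      sudoku⇒graph with rows⇒graph row₀ | column₀ 1# 0# | column₀ 0# 1#
      ... | C , g≡C | a₁ , b₁ , e₁∈g , _ | a₂ , b₂ , e₂∈g , _ =
        C , (D , CD≈I , right-inverse⇒left-inverse CD≈I injective) , c₁₂≉0 , g≡C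
        where
        D : M2 F
        D = m2 a₁ a₂ b₁ b₂
        ∈⇒Sends : ∀ {α β σ τ} → g ∈g v4 α β σ τ → Sends C α β σ τ
        ∈⇒Sends = Equivalence.to (∈⇔Sends g≡C _)
        Sends⇒∈ : ∀ {α β σ τ} → Sends C α β σ τ → g ∈g v4 α β σ τ
        Sends⇒∈ = Equivalence.from (∈⇔Sends g≡C _)
        CD≈I : RightInverse C D
        CD≈I = Sends-columns⇒RightInverse (∈⇒Sends e₁∈g) (∈⇒Sends e₂∈g)
        injective : ∀ {α β α' β' σ τ} → Sends C α β σ τ → Sends C α' β' σ τ → (α ≈ α') × (β ≈ β')
        injective sC sC' = ∃!₂-unique (column₀ _ _) (Sends⇒∈ sC) (Sends⇒∈ sC')
        c₁₂≉0 : ¬ (m₁₂ C ≈ 0#)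
        c₁₂≉0 c₁₂≈0 = 0≉1 (sym (proj₁ (∃!₂-unique (subsquare₀ 0# 0#) e₂∈g' (∈-0 g))))
          where
          e₂∈g' : g ∈g v4 0# 1# 0# (m₂₂ C)
          e₂∈g' = ∈-resp g (refl , refl , c₁₂≈0 , refl) (Sends⇒∈ (Sends-e₂ C))

proposition2p2 : ∀ {c ℓ p : Level} (F : FiniteField c ℓ) → CharNot2 F →
    (g : Subspace F p) → TwoDimensional F g →
    GeneratesParallelSudoku F g ⇔
      (∃ λ C → Invertible F C × ¬ (FiniteField._≈_ F (m₁₂ C) (FiniteField.0# F))
               × _≡[_/_] F g (I₂ F) C)
proposition2p2 F _ g _ =
  mk⇔ (sudoku⇒graph F g) (λ { (C , invertible , c₁₂≉0 , g≡C) → graph⇒sudoku F g g≡C invertible c₁₂≉0 })
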